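{- Let $(M,+,0,E)$ be a flow domain such that $M$ is a positive monoid and $E$ is a nilpotent set of endomorphisms. Then this flow domain has unique flows: for every graph $(N,e)$ over it and every $\mathit{in}\colon N\to M$ there exists a unique $\mathit{flow}\colon N\to M$ satisfying $\mathsf{FlowEqn}(\mathit{in},e,\mathit{flow})$.
   Context: A flow domain $(M,+,0,E)$: $(M,+,0)$ a commutative cancellative monoid and $E$ a set of functions $M\to M$. $M$ is positive if $m_1+m_2=0$ implies $m_1=m_2=0$. An endomorphism of $M$ is $f\colon M\to M$ with $f(m_1+m_2)=f(m_1)+f(m_2)$. A set $E$ of endomorphisms is closed if $f\circ f'\in E$ and $f+f'\in E$ for all $f,f'\in E$ (with $(f+f')(m)=f(m)+f'(m)$); it is nilpotent if it is closed and there exists $p>1$ such that $f^p$ (the $p$-fold composition of $f$ with itself) is the constant-$0$ function for every $f\in E$. Fix a node set $\mathfrak{N}$; a graph is $(N,e)$ with $N\subseteq\mathfrak{N}$ finite and $e\colon N\times\mathfrak{N}\to E$. $\mathsf{FlowEqn}(\mathit{in},e,\mathit{flow})$ means $\mathit{flow}(n)=\mathit{in}(n)+\sum_{n'\in N}e(n',n)(\mathit{flow}(n'))$ for all $n\in N$. -}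

module Defs where

open import Data.Nat using (ℕ; zero; suc; _>_)
open import Data.Product using (Σ; _×_; ∃-syntax)
open import Data.List using (List; []; _∷_)
open import Data.List.Membership.Propositional using (_∈_)
open import Data.List.Relation.Unary.Unique.Propositional using (Unique)
open import Relation.Binary.PropositionalEquality using (_≡_)

record FlowDomain : Set₁ where
  field
    M      : Set
    _⊕_    : M → M → M
    𝟘      : M
    ⊕-assoc : ∀ a b c → (a ⊕ b) ⊕ c ≡ a ⊕ (b ⊕ c)
    ⊕-comm  : ∀ a b → a ⊕ b ≡ b ⊕ a
    ⊕-identityˡ : ∀ a → 𝟘 ⊕ a ≡ a
    ⊕-cancelˡ : ∀ a b c → a ⊕ b ≡ a ⊕ c → b ≡ c
    E      : (M → M) → Set

module _ (D : FlowDomain) where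
  open FlowDomain D

  Positive : Set
  Positive = ∀ m₁ m₂ → m₁ ⊕ m₂ ≡ 𝟘 → (m₁ ≡ 𝟘) × (m₂ ≡ 𝟘)

  IsEndomorphism : (M → M) → Set
  IsEndomorphism f = ∀ m₁ m₂ → f (m₁ ⊕ m₂) ≡ f m₁ ⊕ f m₂

  iterate : ℕ → (M → M) → M → M
  iterate zero    f m = m
  iterate (suc p) f m = f (iterate p f m)

  Closed : Set
  Closed = (∀ f → E f → IsEndomorphism f)
         × (∀ f f′ → E f → E f′ → E (λ m → f (f′ m)))
         × (∀ f f′ → E f → E f′ → E (λ m → f m ⊕ f′ m))

  Nilpotent : Set
  Nilpotent = Closed × ∃[ p ] (p > 1 × (∀ f → E f → ∀ m → iterate p f m ≡ 𝟘))

  sumOver : {Node : Set} → List Node → (Node → M) → M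
  sumOver []       g = 𝟘
  sumOver (x ∷ xs) g = g x ⊕ sumOver xs g

  -- A graph over node set Node: finite N ⊆ Node (duplicate-free list)
  -- and e : N × Node → E.
  record Graph (Node : Set) : Set where
    field
      N      : List Node
      N-uniq : Unique N
      e      : Node → Node → (M → M)
      e∈E    : ∀ n → n ∈ N → ∀ n′ → E (e n n′)

  -- FlowEqn(in, e, flow); in and flow are only consulted on N.
  FlowEqn : {Node : Set} (G : Graph Node) → (Node → M) → (Node → M) → Set
  FlowEqn G inf flow =
    ∀ n → n ∈ Graph.N G → flow n ≡ inf n ⊕ sumOver (Graph.N G) (λ n′ → Graph.e G n′ n (flow n′))

  HasUniqueFlows : (Node : Set) → Set
  HasUniqueFlows Node = (G : Graph Node) (inf : Node → M) →
      (Σ (Node → M) λ flow → FlowEqn G inf flow)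
    × (∀ f₁ f₂ → FlowEqn G inf f₁ → FlowEqn G inf f₂ → ∀ n → n ∈ Graph.N G → f₁ n ≡ f₂ n)

-- Write step x = in + Σₐ e(a,-)(x a) for the flow operator, so that flows are exactly its fixed
-- points on N.  Since the edge functions are endomorphisms, stepᵏ x = stepᵏ 0 + propagateᵏ x,
-- where propagate is the linear part of step.  In the algebraic preorder m ∣ʳ m′ of M (q + m = m′
-- for some q) every value of propagateᵏ x on N lies below gᵏ (Σ x) for the single
-- endomorphism g = Σ_b Σ_a e(a,b) ∈ E, so by nilpotency and positivity propagateᵖ x vanishes
-- on N.  Hence stepᵖ x does not depend on x on N: stepᵖ 0 is a flow, and every flow equals it.
module Submission where

open import Algebra.Bundles using (CommutativeMonoid)
open import Algebra.Structures.Biased using (isCommutativeMonoidˡ)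
open import Data.List using (List; []; _∷_)
open import Data.List.Membership.Propositional using (_∈_)
open import Data.List.Relation.Unary.Any using (here; there)
open import Data.Nat using (ℕ; zero; suc; _+_)
open import Data.Nat.GeneralisedArithmetic using (fold; fold-+)
open import Data.Nat.Properties using (+-comm)
open import Data.Product using (Σ; _×_; _,_; proj₁; proj₂; ∃-syntax)
open import Function using (const)
open import Level using (0ℓ)
open import Relation.Binary.PropositionalEquality

open import Defs

module _ (D : FlowDomain) where
  open FlowDomain D

  ⊕-commutativeMonoid : CommutativeMonoid 0ℓ 0ℓ
  ⊕-commutativeMonoid = record
    { isCommutativeMonoid = isCommutativeMonoidˡ record
      { isSemigroup = record
        { isMagma = record { isEquivalence = isEquivalence ; ∙-cong = cong₂ _⊕_ }
        ; assoc   = ⊕-assoc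
        }
      ; identityˡ = ⊕-identityˡ
      ; comm      = ⊕-comm
      }
    }

  open CommutativeMonoid ⊕-commutativeMonoid using (identityʳ; monoid; commutativeSemigroup)
  open import Algebra.Properties.CommutativeSemigroup commutativeSemigroup using (interchange)
  open import Algebra.Properties.Monoid.Divisibility monoid
    using (_∣ʳ_; _,_; ∣ʳ-refl; ∣ʳ-trans; x∣ʳyx)
  open import Algebra.Properties.CommutativeSemigroup.Divisibility commutativeSemigroup
    using (∙-cong-∣; x∣xy)

  ∣ʳ𝟘⇒≡𝟘 : Positive D → ∀ {m} → m ∣ʳ 𝟘 → m ≡ 𝟘
  ∣ʳ𝟘⇒≡𝟘 positive {m} (q , q⊕m≡𝟘) = proj₂ (positive q m q⊕m≡𝟘)

  endomorphism-mono : ∀ {f} → IsEndomorphism D f → ∀ {m m′} → m ∣ʳ m′ → f m ∣ʳ f m′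
  endomorphism-mono {f} f-hom {m} (q , q⊕m≡m′) = f q , trans (sym (f-hom q m)) (cong f q⊕m≡m′)

  module _ {Node : Set} where

    sumOver-cong : ∀ (xs : List Node) {h h′ : Node → M} →
                   (∀ x → x ∈ xs → h x ≡ h′ x) → sumOver D xs h ≡ sumOver D xs h′
    sumOver-cong []       h≡h′ = refl
    sumOver-cong (x ∷ xs) h≡h′ =
      cong₂ _⊕_ (h≡h′ x (here refl)) (sumOver-cong xs (λ y y∈xs → h≡h′ y (there y∈xs)))

    sumOver-mono : ∀ (xs : List Node) {h h′ : Node → M} →
                   (∀ x → x ∈ xs → h x ∣ʳ h′ x) → sumOver D xs h ∣ʳ sumOver D xs h′
    sumOver-mono []       h∣h′ = ∣ʳ-refl
    sumOver-mono (x ∷ xs) h∣h′ =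
      ∙-cong-∣ (h∣h′ x (here refl)) (sumOver-mono xs (λ y y∈xs → h∣h′ y (there y∈xs)))

    ∈⇒∣ʳsumOver : ∀ {xs : List Node} (h : Node → M) {x} → x ∈ xs → h x ∣ʳ sumOver D xs h
    ∈⇒∣ʳsumOver h (here refl) = x∣xy _ _
    ∈⇒∣ʳsumOver h (there x∈xs) = ∣ʳ-trans (∈⇒∣ʳsumOver h x∈xs) (x∣ʳyx _ _)

    sumOver-⊕ : ∀ (xs : List Node) (h h′ : Node → M) →
                sumOver D xs (λ x → h x ⊕ h′ x) ≡ sumOver D xs h ⊕ sumOver D xs h′
    sumOver-⊕ []       h h′ = sym (identityʳ 𝟘)
    sumOver-⊕ (x ∷ xs) h h′ =
      trans (cong ((h x ⊕ h′ x) ⊕_) (sumOver-⊕ xs h h′)) (interchange _ _ _ _)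

    -- A sum over the nonempty list x ∷ xs without the trailing 𝟘 of sumOver: the pointwise
    -- sum of members of E is then syntactically a nested ⊕ of them, which matters because E
    -- need not be closed under pointwise equality.
    sum⁺ : Node → List Node → (Node → M) → M
    sum⁺ x []       h = h x
    sum⁺ x (y ∷ xs) h = h x ⊕ sum⁺ y xs h

    sum⁺≡sumOver : ∀ x xs (h : Node → M) → sum⁺ x xs h ≡ sumOver D (x ∷ xs) h
    sum⁺≡sumOver x []       h = sym (identityʳ (h x))
    sum⁺≡sumOver x (y ∷ xs) h = cong (h x ⊕_) (sum⁺≡sumOver y xs h)

    sum⁺-∈E : Closed D → ∀ x xs (h : Node → M → M) → (∀ y → y ∈ x ∷ xs → E (h y)) →
              E (λ m → sum⁺ x xs (λ y → h y m))
    sum⁺-∈E closed x []       h h∈E = h∈E x (here refl)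
    sum⁺-∈E closed@(_ , _ , ⊕-closed) x (y ∷ xs) h h∈E =
      ⊕-closed (h x) _ (h∈E x (here refl)) (sum⁺-∈E closed y xs h (λ z z∈ → h∈E z (there z∈)))

    Dominates : List Node → (Node → Node → M → M) → (M → M) → Set
    Dominates ns e g = ∀ b → b ∈ ns → ∀ m → sumOver D ns (λ a → e a b m) ∣ʳ g m

    -- A node is needed because E may not contain the constant 𝟘.
    dominating-∈E : Closed D → ∀ {ns : List Node} (e : Node → Node → M → M) →
                    (∀ a → a ∈ ns → ∀ b → E (e a b)) → ∀ {n} → n ∈ ns →
                    ∃[ g ] E g × Dominates ns e g
    dominating-∈E closed {x ∷ xs} e e∈E _ =
        g
      , sum⁺-∈E closed x xs inner (λ b _ → sum⁺-∈E closed x xs (λ a → e a b) (λ a a∈ → e∈E a a∈ b))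
      , dominates
      where
      inner : Node → M → M
      inner b m = sum⁺ x xs (λ a → e a b m)

      g : M → M
      g m = sum⁺ x xs (λ b → inner b m)

      dominates : Dominates (x ∷ xs) e g
      dominates b b∈ m = subst₂ _∣ʳ_ (sum⁺≡sumOver x xs _) (sym (sum⁺≡sumOver x xs _))
        (∈⇒∣ʳsumOver (λ b′ → inner b′ m) b∈)

  module FlowOperator (positive : Positive D) (nilpotent : Nilpotent D)
                      {Node : Set} (G : Graph D Node) (inf : Node → M) where
    open Graph G

    closed : Closed D
    closed = proj₁ nilpotent

    p : ℕ
    p = proj₁ (proj₂ nilpotent)

    iterate-p≡𝟘 : ∀ f → E f → ∀ m → iterate D p f m ≡ 𝟘
    iterate-p≡𝟘 = proj₂ (proj₂ (proj₂ nilpotent))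

    e-hom : ∀ {a} → a ∈ N → ∀ b → IsEndomorphism D (e a b)
    e-hom {a} a∈N b = proj₁ closed (e a b) (e∈E a a∈N b)

    𝟘ᶠ : Node → M
    𝟘ᶠ = const 𝟘

    propagate : (Node → M) → Node → M
    propagate x b = sumOver D N (λ a → e a b (x a))

    step : (Node → M) → Node → M
    step x b = inf b ⊕ propagate x b

    propagate-⊕ : ∀ (x y : Node → M) b →
                  propagate (λ n → x n ⊕ y n) b ≡ propagate x b ⊕ propagate y b
    propagate-⊕ x y b =
      trans (sumOver-cong N (λ a a∈N → e-hom a∈N b (x a) (y a))) (sumOver-⊕ N _ _)

    propagate-bound : ∀ {y : Node → M} {Y} → (∀ a → a ∈ N → y a ∣ʳ Y) →
                      ∀ b → propagate y b ∣ʳ sumOver D N (λ a → e a b Y)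
    propagate-bound y∣Y b = sumOver-mono N (λ a a∈N → endomorphism-mono (e-hom a∈N b) (y∣Y a a∈N))

    fold-step-decompose : ∀ x k b → fold x step k b ≡ fold 𝟘ᶠ step k b ⊕ fold x propagate k b
    fold-step-decompose x zero    b = sym (⊕-identityˡ (x b))
    fold-step-decompose x (suc k) b = begin
      inf b ⊕ propagate (fold x step k) b
        ≡⟨ cong (inf b ⊕_) (sumOver-cong N (λ a _ → cong (e a b) (fold-step-decompose x k a))) ⟩
      inf b ⊕ propagate (λ n → fold 𝟘ᶠ step k n ⊕ fold x propagate k n) b
        ≡⟨ cong (inf b ⊕_) (propagate-⊕ _ _ b) ⟩
      inf b ⊕ (propagate (fold 𝟘ᶠ step k) b ⊕ propagate (fold x propagate k) b)
        ≡⟨ sym (⊕-assoc _ _ _) ⟩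
      step (fold 𝟘ᶠ step k) b ⊕ propagate (fold x propagate k) b
        ∎
      where open ≡-Reasoning

    fold-propagate-bound : ∀ {g} → E g → Dominates N e g → ∀ x k b → b ∈ N →
                           fold x propagate k b ∣ʳ iterate D k g (sumOver D N x)
    fold-propagate-bound g∈E dominates x zero    b b∈N = ∈⇒∣ʳsumOver x b∈N
    fold-propagate-bound g∈E dominates x (suc k) b b∈N =
      ∣ʳ-trans (propagate-bound (λ a a∈N → fold-propagate-bound g∈E dominates x k a a∈N) b)
               (dominates b b∈N _)

    fold-propagate-p≡𝟘 : ∀ x b → b ∈ N → fold x propagate p b ≡ 𝟘
    fold-propagate-p≡𝟘 x b b∈N with dominating-∈E closed e e∈E b∈N
    ... | g , g∈E , dominates = ∣ʳ𝟘⇒≡𝟘 positive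
      (subst (_ ∣ʳ_) (iterate-p≡𝟘 g g∈E _) (fold-propagate-bound g∈E dominates x p b b∈N))

    fold-step-p-constant : ∀ x b → b ∈ N → fold x step p b ≡ fold 𝟘ᶠ step p b
    fold-step-p-constant x b b∈N = begin
      fold x step p b                        ≡⟨ fold-step-decompose x p b ⟩
      fold 𝟘ᶠ step p b ⊕ fold x propagate p b ≡⟨ cong (_ ⊕_) (fold-propagate-p≡𝟘 x b b∈N) ⟩
      fold 𝟘ᶠ step p b ⊕ 𝟘                    ≡⟨ identityʳ _ ⟩
      fold 𝟘ᶠ step p b                        ∎
      where open ≡-Reasoning

    flow⇒fold-step : ∀ {flow} → FlowEqn D G inf flow → ∀ k n → n ∈ N → flow n ≡ fold flow step k n
    flow⇒fold-step eqn zero    n n∈N = refl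
    flow⇒fold-step eqn (suc k) n n∈N = trans (eqn n n∈N)
      (cong (inf n ⊕_) (sumOver-cong N (λ a a∈N → cong (e a n) (flow⇒fold-step eqn k a a∈N))))

    flow-exists : Σ (Node → M) λ flow → FlowEqn D G inf flow
    flow-exists = fold 𝟘ᶠ step p , λ n n∈N → begin
      fold 𝟘ᶠ step p n          ≡⟨ sym (fold-step-p-constant (step 𝟘ᶠ) n n∈N) ⟩
      fold (step 𝟘ᶠ) step p n   ≡⟨ cong (λ x → x n) (sym (fold-+ 𝟘ᶠ step p)) ⟩
      fold 𝟘ᶠ step (p + 1) n    ≡⟨ cong (λ k → fold 𝟘ᶠ step k n) (+-comm p 1) ⟩
      step (fold 𝟘ᶠ step p) n   ∎
      where open ≡-Reasoning

    flows-agree : ∀ flow₁ flow₂ → FlowEqn D G inf flow₁ → FlowEqn D G inf flow₂ →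
                  ∀ n → n ∈ N → flow₁ n ≡ flow₂ n
    flows-agree flow₁ flow₂ eqn₁ eqn₂ n n∈N = begin
      flow₁ n               ≡⟨ flow⇒fold-step eqn₁ p n n∈N ⟩
      fold flow₁ step p n   ≡⟨ fold-step-p-constant flow₁ n n∈N ⟩
      fold 𝟘ᶠ step p n      ≡⟨ sym (fold-step-p-constant flow₂ n n∈N) ⟩
      fold flow₂ step p n   ≡⟨ sym (flow⇒fold-step eqn₂ p n n∈N) ⟩
      flow₂ n               ∎
      where open ≡-Reasoning

lemma7 : (Node : Set) (D : FlowDomain) → Positive D → Nilpotent D → HasUniqueFlows D Node
lemma7 Node D positive nilpotent G inf = flow-exists , flows-agree
  where open FlowOperator D positive nilpotent G inf
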